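{- Let $G$ be a connected graph on $n$ vertices and $H$ a connected graph on $k\ge 2$ vertices with diameter $D_H$. Then $$\lambda(G,H)\ge \frac{2k}{D_H^2\,\mathrm{vol}(G)\,(k-1)}.$$
   Context: All graphs are finite and simple. For a graph $G$, $d_v$ denotes the degree of $v$, $u\sim v$ means adjacency, and $\mathrm{vol}(G)=\sum_v d_v$. For a metric space $(X,d)$ and $f:V(G)\to X$ set $R_f(G,X)=\frac{\mathrm{vol}(G)\sum_{u\sim v} d(f(u),f(v))^2}{\sum_{u,v} d(f(u),f(v))^2 d_u d_v}$, where the numerator sum is over edges of $G$ and the denominator sum over unordered pairs of vertices; $\lambda(G,X)=\inf_f R_f(G,X)$ over all $f$ with nonzero denominator. A connected graph $H$ is regarded as the metric space $(V(H),d_H)$ with shortest-path distance, $\lambda(G,H)=\lambda(G,(V(H),d_H))$, and $D_H$ is the diameter of $H$. -}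

module Defs where

open import Data.Nat using (ℕ; zero; suc; _+_; _*_; _∸_; _<ᵇ_; _⊔_)
open import Data.Fin using (Fin; toℕ)
open import Data.Fin.Base using () renaming (zero to fzero; suc to fsuc)
open import Data.Bool using (Bool; true; false; if_then_else_; _∧_; _∨_; T)
open import Data.Product using (∃-syntax)
open import Data.Integer using (+_)
open import Data.Rational using (ℚ; _/_; 0ℚ)
open import Relation.Binary.PropositionalEquality using (_≡_)

record Graph (n : ℕ) : Set where
  field
    adj    : Fin n → Fin n → Bool
    sym    : ∀ u v → adj u v ≡ adj v u
    irrefl : ∀ u → adj u u ≡ false
open Graph public

∑ : (n : ℕ) → (Fin n → ℕ) → ℕ
∑ zero    f = 0
∑ (suc n) f = f fzero + ∑ n (λ i → f (fsuc i))

bigMax : (n : ℕ) → (Fin n → ℕ) → ℕ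
bigMax zero    f = 0
bigMax (suc n) f = f fzero ⊔ bigMax n (λ i → f (fsuc i))

anyFin : (n : ℕ) → (Fin n → Bool) → Bool
anyFin zero    p = false
anyFin (suc n) p = p fzero ∨ anyFin n (λ i → p (fsuc i))

deg : ∀ {n} → Graph n → Fin n → ℕ
deg {n} G u = ∑ n (λ v → if adj G u v then 1 else 0)

vol : ∀ {n} → Graph n → ℕ
vol {n} G = ∑ n (deg G)

data Walk {n : ℕ} (G : Graph n) : Fin n → Fin n → ℕ → Set where
  here : ∀ u → Walk G u u 0
  step : ∀ {u w v l} → T (adj G u w) → Walk G w v l → Walk G u v (suc l)

Connected : ∀ {n} → Graph n → Set
Connected G = ∀ u v → ∃[ l ] Walk G u v l

_≟ᵇ_ : ∀ {n} → Fin n → Fin n → Bool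
u ≟ᵇ v = if toℕ u <ᵇ toℕ v then false else (if toℕ v <ᵇ toℕ u then false else true)

within : ∀ {n} → Graph n → ℕ → Fin n → Fin n → Bool
within G zero    u v = u ≟ᵇ v
within {n} G (suc l) u v = within G l u v ∨ anyFin n (λ w → adj G u w ∧ within G l w v)

search : ℕ → ℕ → (ℕ → Bool) → ℕ
search zero     l p = l
search (suc fu) l p = if p l then l else search fu (suc l) p

-- Shortest-path distance d_H (for a connected graph on k vertices the
-- shortest walk has length < k, so the search over 0..k-1 finds it).
dist : ∀ {k} → Graph k → Fin k → Fin k → ℕ
dist {k} H u v = search k 0 (λ l → within H l u v)

diam : ∀ {k} → Graph k → ℕ
diam {k} H = bigMax k (λ u → bigMax k (λ v → dist H u v))

∑pairs : (n : ℕ) → (Fin n → Fin n → ℕ) → ℕ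
∑pairs n g = ∑ n (λ u → ∑ n (λ v → if toℕ u <ᵇ toℕ v then g u v else 0))

edgeSum : ∀ {n k} → Graph n → Graph k → (Fin n → Fin k) → ℕ
edgeSum {n} G H f =
  ∑pairs n (λ u v → if adj G u v then dist H (f u) (f v) * dist H (f u) (f v) else 0)

denom : ∀ {n k} → Graph n → Graph k → (Fin n → Fin k) → ℕ
denom {n} G H f =
  ∑pairs n (λ u v → dist H (f u) (f v) * dist H (f u) (f v) * deg G u * deg G v)

-- p / q as a rational (only used with q ≠ 0; value 0 for q = 0).
frac : ℕ → ℕ → ℚ
frac p zero    = 0ℚ
frac p (suc q) = (+ p) / suc q

Rf : ∀ {n k} → Graph n → Graph k → (Fin n → Fin k) → ℚ
Rf G H f = frac (vol G * edgeSum G H f) (denom G H f)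

-- Bound every squared distance d_H(f u, f v)² by D_H², so the denominator is at
-- most D_H² times the degree mass of the pairs that f separates. Grouping the
-- degrees by colour class W_c = ∑_{f v = c} d_v, that mass is (vol² − ∑_c W_c²)/2,
-- and Cauchy–Schwarz ∑_c W_c² ≥ vol²/k bounds it by (k − 1) vol² / 2k. Finally
-- the numerator edge sum is at least 1: f is not constant (the denominator is
-- non-zero), so a walk in the connected graph G crosses an edge whose endpoints
-- f separates.
module Submission where

open import Defs hiding (sym)
open import Data.Nat using (ℕ; _*_; _∸_; _≤_)
open import Data.Fin using (Fin)
open import Data.Rational using () renaming (_≤_ to _≤ℚ_)
open import Relation.Binary.PropositionalEquality using (_≢_)

open import Data.Bool using (true; false; if_then_else_; T)
open import Data.Empty using (⊥-elim)
open import Data.Fin using (toℕ; _≟_) renaming (zero to fzero; suc to fsuc)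
open import Data.Fin.Properties using (toℕ-injective)
import Data.Integer as ℤ
import Data.Integer.Properties as ℤ
import Data.Nat as ℕ
open import Data.Nat using (zero; suc; _+_; _<_; _<ᵇ_; z≤n)
open import Data.Nat.Properties hiding (_≟_)
import Algebra.Properties.Semiring.Sum +-*-semiring as Sum
open import Data.Nat.Solver using (module +-*-Solver)
open import Data.Product using (∃-syntax; _,_; _×_; proj₂)
open import Data.Rational.Properties using (toℚᵘ-cancel-≤; toℚᵘ-fromℚᵘ)
import Data.Rational.Unnormalised as ℚᵘ
import Data.Rational.Unnormalised.Properties as ℚᵘ
open import Data.Sum using (inj₁; inj₂)
open import Function.Base using (_∘_)
open import Function.Bundles using (mk⇔)
open import Relation.Binary.Definitions using (tri<; tri≈; tri>)
open import Relation.Binary.PropositionalEquality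
  using (_≡_; refl; sym; trans; cong; cong₂; subst; subst₂; module ≡-Reasoning)
open import Relation.Nullary using (yes; no; does)
open import Relation.Nullary.Decidable using (dec-true; does-⇔)

open +-*-Solver using (solve; _:+_; _:*_; _:=_; con)

frac-≤ : ∀ p q r s → s ≢ 0 → p * s ≤ r * q → frac p q ≤ℚ frac r s
frac-≤ p q       r zero    s≢0 _ = ⊥-elim (s≢0 refl)
frac-≤ p zero    r (suc s) _   _ = frac-≤ 0 1 r (suc s) (λ ()) z≤n
frac-≤ p (suc q) r (suc s) _   ps≤rq = toℚᵘ-cancel-≤
  (ℚᵘ.≤-respʳ-≃ (ℚᵘ.≃-sym (toℚᵘ-fromℚᵘ (ℚᵘ.mkℚᵘ (ℤ.+ r) s)))
  (ℚᵘ.≤-respˡ-≃ (ℚᵘ.≃-sym (toℚᵘ-fromℚᵘ (ℚᵘ.mkℚᵘ (ℤ.+ p) q)))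
  (ℚᵘ.*≤* (subst₂ ℤ._≤_ (ℤ.pos-* p (suc s)) (ℤ.pos-* r (suc q)) (ℤ.+≤+ ps≤rq)))))

∑≡sum : ∀ n (f : Fin n → ℕ) → ∑ n f ≡ Sum.sum f
∑≡sum zero    f = refl
∑≡sum (suc n) f = cong (f fzero +_) (∑≡sum n (λ i → f (fsuc i)))

∑-cong : ∀ n {f g : Fin n → ℕ} → (∀ i → f i ≡ g i) → ∑ n f ≡ ∑ n g
∑-cong zero    f≗g = refl
∑-cong (suc n) f≗g = cong₂ _+_ (f≗g fzero) (∑-cong n (λ i → f≗g (fsuc i)))

∑-mono : ∀ n {f g : Fin n → ℕ} → (∀ i → f i ≤ g i) → ∑ n f ≤ ∑ n g
∑-mono zero    f≤g = z≤n
∑-mono (suc n) f≤g = +-mono-≤ (f≤g fzero) (∑-mono n (λ i → f≤g (fsuc i)))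

∑-const : ∀ n c → ∑ n (λ _ → c) ≡ n * c
∑-const zero    c = refl
∑-const (suc n) c = cong (c +_) (∑-const n c)

∑-distrib-+ : ∀ n (f g : Fin n → ℕ) → ∑ n (λ i → f i + g i) ≡ ∑ n f + ∑ n g
∑-distrib-+ n f g = trans (∑≡sum n _) (trans (Sum.∑-distrib-+ f g)
  (sym (cong₂ _+_ (∑≡sum n f) (∑≡sum n g))))

*-distribˡ-∑ : ∀ n c (f : Fin n → ℕ) → c * ∑ n f ≡ ∑ n (λ i → c * f i)
*-distribˡ-∑ n c f = trans (cong (c *_) (∑≡sum n f))
  (trans (Sum.*-distribˡ-sum c f) (sym (∑≡sum n _)))

*-distribʳ-∑ : ∀ n c (f : Fin n → ℕ) → ∑ n f * c ≡ ∑ n (λ i → f i * c)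
*-distribʳ-∑ n c f = trans (cong (_* c) (∑≡sum n f))
  (trans (Sum.*-distribʳ-sum c f) (sym (∑≡sum n _)))

∑-comm : ∀ m n (h : Fin m → Fin n → ℕ) →
  ∑ m (λ i → ∑ n (h i)) ≡ ∑ n (λ j → ∑ m (λ i → h i j))
∑-comm m n h = trans (∑∑≡sumsum m n h)
  (trans (Sum.∑-comm h) (sym (∑∑≡sumsum n m (λ j i → h i j))))
  where
  ∑∑≡sumsum : ∀ m n (h : Fin m → Fin n → ℕ) → ∑ m (λ i → ∑ n (h i)) ≡ Sum.sum (λ i → Sum.sum (h i))
  ∑∑≡sumsum m n h = trans (∑≡sum m _) (Sum.sum-cong-≗ (λ i → ∑≡sum n (h i)))

≤-∑ : ∀ n (f : Fin n → ℕ) i → f i ≤ ∑ n f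
≤-∑ (suc n) f fzero    = m≤m+n _ _
≤-∑ (suc n) f (fsuc i) = ≤-trans (≤-∑ n (λ j → f (fsuc j)) i) (m≤n+m _ _)

∑≢0⇒∃≢0 : ∀ n (f : Fin n → ℕ) → ∑ n f ≢ 0 → ∃[ i ] f i ≢ 0
∑≢0⇒∃≢0 zero    f ∑f≢0 = ⊥-elim (∑f≢0 refl)
∑≢0⇒∃≢0 (suc n) f ∑f≢0 with f fzero ℕ.≟ 0
... | no f0≢0 = fzero , f0≢0
... | yes f0≡0 with ∑≢0⇒∃≢0 n (λ i → f (fsuc i)) (λ ∑≡0 → ∑f≢0 (cong₂ _+_ f0≡0 ∑≡0))
...   | i , fi≢0 = fsuc i , fi≢0

∑-select : ∀ k (a : Fin k) (h : Fin k → ℕ) → ∑ k (λ c → if does (c ≟ a) then h c else 0) ≡ h a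
∑-select (suc k) fzero    h = trans (cong (h fzero +_) (trans (∑-const k 0) (*-zeroʳ k))) (+-identityʳ _)
∑-select (suc k) (fsuc a) h = ∑-select k a (λ c → h (fsuc c))

≤-bigMax : ∀ n (f : Fin n → ℕ) i → f i ≤ bigMax n f
≤-bigMax (suc n) f fzero    = m≤m⊔n _ _
≤-bigMax (suc n) f (fsuc i) = m≤n⇒m≤o⊔n (f fzero) (≤-bigMax n (λ j → f (fsuc j)) i)

if-*ˡ : ∀ b c x → (if b then c * x else 0) ≡ c * (if b then x else 0)
if-*ˡ true  c x = refl
if-*ˡ false c x = sym (*-zeroʳ c)

if-mono : ∀ b {x y} → x ≤ y → (if b then x else 0) ≤ (if b then y else 0)
if-mono true  x≤y = x≤y
if-mono false x≤y = z≤n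

2x[x+t]≤x²+[x+t]² : ∀ x t → 2 * (x * (x + t)) ≤ x * x + (x + t) * (x + t)
2x[x+t]≤x²+[x+t]² x t = subst (2 * (x * (x + t)) ≤_) (square-gap x t) (m≤m+n _ (t * t))
  where
  square-gap : ∀ x t → 2 * (x * (x + t)) + t * t ≡ x * x + (x + t) * (x + t)
  square-gap = solve 2 (λ x t → con 2 :* (x :* (x :+ t)) :+ t :* t
                              := x :* x :+ (x :+ t) :* (x :+ t)) refl

2xy≤x²+y² : ∀ x y → 2 * (x * y) ≤ x * x + y * y
2xy≤x²+y² x y with ≤-total x y
... | inj₁ x≤y = subst (λ y → 2 * (x * y) ≤ x * x + y * y) (m+[n∸m]≡n x≤y) (2x[x+t]≤x²+[x+t]² x (y ∸ x))
... | inj₂ y≤x = subst₂ _≤_ (cong (2 *_) (*-comm y x)) (+-comm (y * y) (x * x))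
  (subst (λ x → 2 * (y * x) ≤ y * y + x * x) (m+[n∸m]≡n y≤x) (2x[x+t]≤x²+[x+t]² y (x ∸ y)))

cauchy-schwarz : ∀ k (x : Fin k → ℕ) → ∑ k x * ∑ k x ≤ k * ∑ k (λ i → x i * x i)
cauchy-schwarz k x = *-cancelˡ-≤ 2 (begin
  2 * (∑ k x * ∑ k x)                           ≡⟨ cong (2 *_) ∑x²≡∑∑xx ⟩
  2 * ∑ k (λ i → ∑ k (λ j → x i * x j))        ≡⟨ *-distribˡ-∑∑ 2 (λ i j → x i * x j) ⟩
  ∑ k (λ i → ∑ k (λ j → 2 * (x i * x j)))      ≤⟨ ∑-mono k (λ i → ∑-mono k (λ j → 2xy≤x²+y² (x i) (x j))) ⟩
  ∑ k (λ i → ∑ k (λ j → x i * x i + x j * x j)) ≡⟨ ∑-cong k (λ i → ∑-distrib-+ k _ _) ⟩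
  ∑ k (λ i → ∑ k (λ _ → x i * x i) + Q)         ≡⟨ ∑-distrib-+ k _ _ ⟩
  ∑ k (λ i → ∑ k (λ _ → x i * x i)) + ∑ k (λ _ → Q)
    ≡⟨ cong₂ _+_ (∑-cong k (λ i → ∑-const k (x i * x i))) (∑-const k Q) ⟩
  ∑ k (λ i → k * (x i * x i)) + k * Q           ≡⟨ cong (_+ k * Q) (sym (*-distribˡ-∑ k k _)) ⟩
  k * Q + k * Q                                 ≡⟨ cong (k * Q +_) (sym (+-identityʳ (k * Q))) ⟩
  2 * (k * Q)                                   ∎)
  where
  open ≤-Reasoning
  Q = ∑ k (λ i → x i * x i)
  ∑x²≡∑∑xx : ∑ k x * ∑ k x ≡ ∑ k (λ i → ∑ k (λ j → x i * x j))
  ∑x²≡∑∑xx = trans (*-distribʳ-∑ k (∑ k x) x) (∑-cong k (λ i → *-distribˡ-∑ k (x i) x))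
  *-distribˡ-∑∑ : ∀ c (h : Fin k → Fin k → ℕ) → c * ∑ k (λ i → ∑ k (h i)) ≡ ∑ k (λ i → ∑ k (λ j → c * h i j))
  *-distribˡ-∑∑ c h = trans (*-distribˡ-∑ k c _) (∑-cong k (λ i → *-distribˡ-∑ k c (h i)))

T⇒≡true : ∀ {b} → T b → b ≡ true
T⇒≡true {true} _ = refl

<ᵇ≡false⇒≥ : ∀ {m n} → (m <ᵇ n) ≡ false → n ≤ m
<ᵇ≡false⇒≥ m≮ᵇn = ≮⇒≥ (λ m<n → subst T m≮ᵇn (<⇒<ᵇ m<n))

∑pairs-mono : ∀ n {g h : Fin n → Fin n → ℕ} → (∀ u v → g u v ≤ h u v) → ∑pairs n g ≤ ∑pairs n h
∑pairs-mono n g≤h = ∑-mono n (λ u → ∑-mono n (λ v → if-mono (toℕ u <ᵇ toℕ v) (g≤h u v)))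

*-distribˡ-∑pairs : ∀ n c (g : Fin n → Fin n → ℕ) → c * ∑pairs n g ≡ ∑pairs n (λ u v → c * g u v)
*-distribˡ-∑pairs n c g = trans (*-distribˡ-∑ n c _) (∑-cong n (λ u →
  trans (*-distribˡ-∑ n c _) (∑-cong n (λ v → sym (if-*ˡ (toℕ u <ᵇ toℕ v) c (g u v))))))

≤-∑pairs : ∀ n (g : Fin n → Fin n → ℕ) {u v} → toℕ u < toℕ v → g u v ≤ ∑pairs n g
≤-∑pairs n g {u} {v} u<v = ≤-trans
  (≤-reflexive (cong (λ b → if b then g u v else 0) (sym (T⇒≡true (<⇒<ᵇ u<v)))))
  (≤-trans (≤-∑ n (λ v → if toℕ u <ᵇ toℕ v then g u v else 0) v)
           (≤-∑ n (λ u → ∑ n (λ v → if toℕ u <ᵇ toℕ v then g u v else 0)) u))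

∑pairs≢0⇒∃≢0 : ∀ n (g : Fin n → Fin n → ℕ) → ∑pairs n g ≢ 0 → ∃[ u ] ∃[ v ] g u v ≢ 0
∑pairs≢0⇒∃≢0 n g ∑g≢0 with ∑≢0⇒∃≢0 n _ ∑g≢0
... | u , ∑gu≢0 with ∑≢0⇒∃≢0 n _ ∑gu≢0
...   | v , guv≢0 = u , v , if≢0 (toℕ u <ᵇ toℕ v) guv≢0
  where
  if≢0 : ∀ b {x} → (if b then x else 0) ≢ 0 → x ≢ 0
  if≢0 true  x≢0 = x≢0
  if≢0 false 0≢0 = ⊥-elim (0≢0 refl)

2*∑pairs≡∑∑ : ∀ n (g : Fin n → Fin n → ℕ) → (∀ u v → g u v ≡ g v u) → (∀ u → g u u ≡ 0) →
  2 * ∑pairs n g ≡ ∑ n (λ u → ∑ n (g u))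
2*∑pairs≡∑∑ n g g-sym g-diag = sym (begin
  ∑ n (λ u → ∑ n (g u))
    ≡⟨ ∑-cong n (λ u → ∑-cong n (λ v → sym (split u v))) ⟩
  ∑ n (λ u → ∑ n (λ v → below u v + below v u))
    ≡⟨ ∑-cong n (λ u → ∑-distrib-+ n _ _) ⟩
  ∑ n (λ u → ∑ n (below u) + ∑ n (λ v → below v u))
    ≡⟨ ∑-distrib-+ n _ _ ⟩
  ∑pairs n g + ∑ n (λ u → ∑ n (λ v → below v u))
    ≡⟨ cong (∑pairs n g +_) (∑-comm n n (λ u v → below v u)) ⟩
  ∑pairs n g + ∑pairs n g
    ≡⟨ cong (∑pairs n g +_) (sym (+-identityʳ _)) ⟩
  2 * ∑pairs n g ∎)
  where
  open ≡-Reasoning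
  below : Fin n → Fin n → ℕ
  below u v = if toℕ u <ᵇ toℕ v then g u v else 0
  split : ∀ u v → below u v + below v u ≡ g u v
  split u v with toℕ u <ᵇ toℕ v in u<v | toℕ v <ᵇ toℕ u in v<u
  ... | true  | true  = ⊥-elim (<-asym (<ᵇ⇒< (toℕ u) (toℕ v) (subst T (sym u<v) _))
                                       (<ᵇ⇒< (toℕ v) (toℕ u) (subst T (sym v<u) _)))
  ... | true  | false = +-identityʳ _
  ... | false | true  = g-sym v u
  ... | false | false = trans (sym (g-diag u)) (cong (g u) (toℕ-injective
                          (≤-antisym (<ᵇ≡false⇒≥ {toℕ v} v<u) (<ᵇ≡false⇒≥ {toℕ u} u<v))))

<ᵇ-irrefl : ∀ m → (m <ᵇ m) ≡ false
<ᵇ-irrefl zero    = refl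
<ᵇ-irrefl (suc m) = <ᵇ-irrefl m

≟ᵇ-refl : ∀ {n} (u : Fin n) → (u ≟ᵇ u) ≡ true
≟ᵇ-refl u rewrite <ᵇ-irrefl (toℕ u) = refl

≟ᵇ⇒≡ : ∀ {n} {u v : Fin n} → (u ≟ᵇ v) ≡ true → u ≡ v
≟ᵇ⇒≡ {u = u} {v} u≟ᵇv with toℕ u <ᵇ toℕ v in u<v | toℕ v <ᵇ toℕ u in v<u
... | false | false = toℕ-injective (≤-antisym (<ᵇ≡false⇒≥ {toℕ v} v<u) (<ᵇ≡false⇒≥ {toℕ u} u<v))

search-≥ : ∀ fuel l p → l ≤ search fuel l p
search-≥ zero       l p = ≤-refl
search-≥ (suc fuel) l p with p l
... | true  = ≤-refl
... | false = ≤-trans (n≤1+n l) (search-≥ fuel (suc l) p)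

dist-refl : ∀ {k} (H : Graph k) x → dist H x x ≡ 0
dist-refl {suc k} H x rewrite ≟ᵇ-refl x = refl

≡⇒dist≡0 : ∀ {k} (H : Graph k) {x y} → x ≡ y → dist H x y ≡ 0
≡⇒dist≡0 H {x} refl = dist-refl H x

dist≡0⇒≡ : ∀ {k} (H : Graph k) {x y} → dist H x y ≡ 0 → x ≡ y
dist≡0⇒≡ {suc k} H {x} {y} d≡0 with x ≟ᵇ y in x≟ᵇy
... | true  = ≟ᵇ⇒≡ x≟ᵇy
... | false with () ← ≤-trans (search-≥ k 1 _) (≤-reflexive d≡0)

dist≤diam : ∀ {k} (H : Graph k) x y → dist H x y ≤ diam H
dist≤diam {k} H x y = ≤-trans (≤-bigMax k (dist H x) y) (≤-bigMax k (λ u → bigMax k (dist H u)) x)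

crossing-edge : ∀ {n k} (G : Graph n) (f : Fin n → Fin k) {u v l} → Walk G u v l → f u ≢ f v →
  ∃[ a ] ∃[ b ] (T (adj G a b) × f a ≢ f b)
crossing-edge G f (here u) fu≢fu = ⊥-elim (fu≢fu refl)
crossing-edge G f (step {u} {w} u~w walk) fu≢fv with f u ≟ f w
... | yes fu≡fw  = crossing-edge G f walk (λ fw≡fv → fu≢fv (trans fu≡fw fw≡fv))
... | no  fu≢fw = u , w , u~w , fu≢fw

module _ {n k : ℕ} (w : Fin n → ℕ) (c : Fin n → Fin k) where

  crossWeight sameWeight : Fin n → Fin n → ℕ
  crossWeight u v = if does (c u ≟ c v) then 0 else w u * w v
  sameWeight  u v = if does (c u ≟ c v) then w u * w v else 0

  classWeight : Fin k → ℕ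
  classWeight x = ∑ n (λ v → if does (x ≟ c v) then w v else 0)

  crossWeight-sym : ∀ u v → crossWeight u v ≡ crossWeight v u
  crossWeight-sym u v rewrite does-⇔ (mk⇔ sym sym) (c u ≟ c v) (c v ≟ c u) with does (c v ≟ c u)
  ... | true  = refl
  ... | false = *-comm (w u) (w v)

  crossWeight-diag : ∀ u → crossWeight u u ≡ 0
  crossWeight-diag u rewrite dec-true (c u ≟ c u) refl = refl

  ∑∑cross+∑∑same≡∑² : ∑ n (λ u → ∑ n (crossWeight u)) + ∑ n (λ u → ∑ n (sameWeight u)) ≡ ∑ n w * ∑ n w
  ∑∑cross+∑∑same≡∑² = begin
    ∑ n (λ u → ∑ n (crossWeight u)) + ∑ n (λ u → ∑ n (sameWeight u))
      ≡⟨ sym (∑-distrib-+ n _ _) ⟩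
    ∑ n (λ u → ∑ n (crossWeight u) + ∑ n (sameWeight u))
      ≡⟨ ∑-cong n (λ u → sym (∑-distrib-+ n _ _)) ⟩
    ∑ n (λ u → ∑ n (λ v → crossWeight u v + sameWeight u v))
      ≡⟨ ∑-cong n (λ u → ∑-cong n (cross+same u)) ⟩
    ∑ n (λ u → ∑ n (λ v → w u * w v))
      ≡⟨ ∑-cong n (λ u → sym (*-distribˡ-∑ n (w u) w)) ⟩
    ∑ n (λ u → w u * ∑ n w)
      ≡⟨ sym (*-distribʳ-∑ n (∑ n w) w) ⟩
    ∑ n w * ∑ n w ∎
    where
    open ≡-Reasoning
    cross+same : ∀ u v → crossWeight u v + sameWeight u v ≡ w u * w v
    cross+same u v with does (c u ≟ c v)
    ... | true  = refl
    ... | false = +-identityʳ _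

  ∑∑same≡∑classWeight² : ∑ n (λ u → ∑ n (sameWeight u)) ≡ ∑ k (λ x → classWeight x * classWeight x)
  ∑∑same≡∑classWeight² = begin
    ∑ n (λ u → ∑ n (sameWeight u))
      ≡⟨ ∑-cong n (λ u → trans (∑-cong n (λ v → if-*ˡ (does (c u ≟ c v)) (w u) (w v)))
                                (sym (*-distribˡ-∑ n (w u) _))) ⟩
    ∑ n (λ u → w u * classWeight (c u))
      ≡⟨ ∑-cong n (λ u → *-comm (w u) (classWeight (c u))) ⟩
    ∑ n (λ u → classWeight (c u) * w u)
      ≡⟨ ∑-cong n (λ u → sym (∑-select k (c u) (λ x → classWeight x * w u))) ⟩
    ∑ n (λ u → ∑ k (λ x → if does (x ≟ c u) then classWeight x * w u else 0))
      ≡⟨ ∑-comm n k _ ⟩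
    ∑ k (λ x → ∑ n (λ u → if does (x ≟ c u) then classWeight x * w u else 0))
      ≡⟨ ∑-cong k (λ x → trans (∑-cong n (λ u → if-*ˡ (does (x ≟ c u)) (classWeight x) (w u)))
                                (sym (*-distribˡ-∑ n (classWeight x) _))) ⟩
    ∑ k (λ x → classWeight x * classWeight x) ∎
    where open ≡-Reasoning

  ∑classWeight≡∑w : ∑ k classWeight ≡ ∑ n w
  ∑classWeight≡∑w = trans (∑-comm k n _) (∑-cong n (λ v → ∑-select k (c v) (λ _ → w v)))

  crossWeight-bound : k * (2 * ∑pairs n crossWeight) ≤ (k ∸ 1) * (∑ n w * ∑ n w)
  crossWeight-bound = begin
    k * (2 * ∑pairs n crossWeight)   ≡⟨ cong (k *_) (2*∑pairs≡∑∑ n crossWeight crossWeight-sym crossWeight-diag) ⟩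
    k * Cross                        ≡⟨ sym (m+n∸n≡m (k * Cross) (k * Same)) ⟩
    k * Cross + k * Same ∸ k * Same  ≡⟨ cong (_∸ k * Same) (trans (sym (*-distribˡ-+ k Cross Same))
                                                                  (cong (k *_) ∑∑cross+∑∑same≡∑²)) ⟩
    k * W² ∸ k * Same                ≤⟨ ∸-monoʳ-≤ (k * W²) W²≤k*Same ⟩
    k * W² ∸ W²                      ≡⟨ cong (k * W² ∸_) (sym (*-identityˡ W²)) ⟩
    k * W² ∸ 1 * W²                  ≡⟨ sym (*-distribʳ-∸ W² k 1) ⟩
    (k ∸ 1) * W²                     ∎
    where
    open ≤-Reasoning
    Cross = ∑ n (λ u → ∑ n (crossWeight u))
    Same  = ∑ n (λ u → ∑ n (sameWeight u))
    W²    = ∑ n w * ∑ n w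
    W²≤k*Same : W² ≤ k * Same
    W²≤k*Same = subst₂ (λ W S → W * W ≤ k * S) ∑classWeight≡∑w (sym ∑∑same≡∑classWeight²)
                       (cauchy-schwarz k classWeight)

module _ {n k : ℕ} (G : Graph n) (H : Graph k) (f : Fin n → Fin k) where

  private
    d² : Fin n → Fin n → ℕ
    d² u v = dist H (f u) (f v) * dist H (f u) (f v)

  denom≤diam²*∑pairs-crossWeight : denom G H f ≤ diam H * diam H * ∑pairs n (crossWeight (deg G) f)
  denom≤diam²*∑pairs-crossWeight =
    ≤-trans (∑pairs-mono n term≤)
            (≤-reflexive (sym (*-distribˡ-∑pairs n (diam H * diam H) (crossWeight (deg G) f))))
    where
    term≤ : ∀ u v → d² u v * deg G u * deg G v ≤ diam H * diam H * crossWeight (deg G) f u v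
    term≤ u v with f u ≟ f v
    ... | yes fu≡fv = subst (λ d → d * d * deg G u * deg G v ≤ diam H * diam H * 0)
                            (sym (≡⇒dist≡0 H fu≡fv)) z≤n
    ... | no  _     = subst (_≤ diam H * diam H * (deg G u * deg G v))
                            (sym (*-assoc (d² u v) (deg G u) (deg G v)))
                            (*-monoˡ-≤ (deg G u * deg G v)
                              (*-mono-≤ (dist≤diam H (f u) (f v)) (dist≤diam H (f u) (f v))))

  separated : ∀ u v → d² u v * deg G u * deg G v ≢ 0 → f u ≢ f v
  separated u v term≢0 fu≡fv = term≢0 (cong (λ d → d * d * deg G u * deg G v) (≡⇒dist≡0 H fu≡fv))

  crossing-term-pos : ∀ {a b} → T (adj G a b) → f a ≢ f b → 1 ≤ (if adj G a b then d² a b else 0)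
  crossing-term-pos {a} {b} a~b fa≢fb rewrite T⇒≡true a~b = *-mono-≤ d>0 d>0
    where
    d>0 : 0 < dist H (f a) (f b)
    d>0 = n≢0⇒n>0 (λ d≡0 → fa≢fb (dist≡0⇒≡ H d≡0))

  edgeSum-pos : Connected G → denom G H f ≢ 0 → 1 ≤ edgeSum G H f
  edgeSum-pos connected denom≢0 with ∑pairs≢0⇒∃≢0 n _ denom≢0
  ... | u , v , term≢0 with crossing-edge G f (proj₂ (connected u v)) (separated u v term≢0)
  ...   | a , b , a~b , fa≢fb with <-cmp (toℕ a) (toℕ b)
  ...     | tri< a<b _ _ = ≤-trans (crossing-term-pos a~b fa≢fb) (≤-∑pairs n _ a<b)
  ...     | tri≈ _ a≡b _ = ⊥-elim (fa≢fb (cong f (toℕ-injective a≡b)))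
  ...     | tri> _ _ b<a = ≤-trans (crossing-term-pos (subst T (Graph.sym G a b) a~b) (fa≢fb ∘ sym))
                                   (≤-∑pairs n _ b<a)

theorem4p5 : (n k : ℕ) (G : Graph n) (H : Graph k) →
    Connected G → Connected H → 2 ≤ k →
    (f : Fin n → Fin k) → denom G H f ≢ 0 →
    frac (2 * k) (diam H * diam H * vol G * (k ∸ 1)) ≤ℚ Rf G H f
theorem4p5 n k G H connected _ _ f denom≢0 =
  frac-≤ (2 * k) (D * D * V * (k ∸ 1)) (V * E) (denom G H f) denom≢0 (begin
    2 * k * denom G H f             ≤⟨ *-monoʳ-≤ (2 * k) (denom≤diam²*∑pairs-crossWeight G H f) ⟩
    2 * k * (D * D * P)             ≡⟨ reorder₁ k D P ⟩
    D * D * (k * (2 * P))           ≤⟨ *-monoʳ-≤ (D * D) (crossWeight-bound (deg G) f) ⟩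
    D * D * ((k ∸ 1) * (V * V))     ≤⟨ m≤m*n _ E ⦃ ℕ.>-nonZero (edgeSum-pos G H f connected denom≢0) ⦄ ⟩
    D * D * ((k ∸ 1) * (V * V)) * E ≡⟨ reorder₂ D (k ∸ 1) V E ⟩
    V * E * (D * D * V * (k ∸ 1))   ∎)
  where
  open ≤-Reasoning
  D = diam H
  V = vol G
  E = edgeSum G H f
  P = ∑pairs n (crossWeight (deg G) f)
  reorder₁ : ∀ k D P → 2 * k * (D * D * P) ≡ D * D * (k * (2 * P))
  reorder₁ = solve 3 (λ k D P → con 2 :* k :* (D :* D :* P) := D :* D :* (k :* (con 2 :* P))) refl
  reorder₂ : ∀ D K V E → D * D * (K * (V * V)) * E ≡ V * E * (D * D * V * K)
  reorder₂ = solve 4 (λ D K V E → D :* D :* (K :* (V :* V)) :* E := V :* E :* (D :* D :* V :* K)) refl
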